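{- For all integers $n>1$, $c\ge 1$ and $0\le k\le (c-1)n+c\binom{n}{2}$, we have $i_c(n,k)=i_c\!\left(n,(c-1)n+c\binom{n}{2}-k\right)$.
   Context: For integers $n\ge1$, $c\ge1$, let $G_{c,n}$ be the set of colored permutations: words $\sigma=\sigma_1^{[c_1]}\cdots\sigma_n^{[c_n]}$ where $|\sigma|=\sigma_1\cdots\sigma_n$ is a permutation of $[n]$ and each color $c_i\in\{0,\dots,c-1\}$. For a permutation $\pi$ of $[n]$, $\mathrm{inv}(\pi)=|\{(i,j):i<j,\ \pi_i>\pi_j\}|$. Let $\mathrm{col}(\sigma)=c_1+\cdots+c_n$ and $\mathrm{inv}_c(\sigma)=\mathrm{inv}(|\sigma|)+\mathrm{col}(\sigma)+c\cdot|\{(i,j):1\le i<j\le n,\ \sigma_i<\sigma_j,\ c_j\ne0\}|$. Define $i_c(n,k)=|\{\sigma\in G_{c,n}:\mathrm{inv}_c(\sigma)=k\}|$. -}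

module Defs where

open import Data.Nat using (ℕ; zero; suc; _+_; _*_; _<_; _<?_)
open import Data.Nat.Properties using (_≟_)
open import Data.Fin using (Fin; toℕ)
open import Data.Vec using (Vec; []; _∷_; toList; zip)
open import Data.List using (List; []; _∷_; length; filter; map; concatMap; cartesianProduct; allFin)
open import Data.Product using (_×_; _,_; proj₁; proj₂)
open import Relation.Nullary using (Dec; yes; no; ¬_)
open import Relation.Nullary.Decidable using (¬?; _×-dec_)
open import Relation.Binary.PropositionalEquality using (_≡_)

allVecs : (m n : ℕ) → List (Vec (Fin m) n)
allVecs m zero    = [] ∷ []
allVecs m (suc n) = concatMap (λ x → map (x ∷_) (allVecs m n)) (allFin m)

-- Entries pairwise distinct (a word of length n over Fin n with distinct
-- entries is exactly a permutation of [n], in one-line notation, 0-based).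
Distinct : {m n : ℕ} → Vec (Fin m) n → Set
Distinct []       = Data.Unit.⊤ where import Data.Unit
Distinct (x ∷ xs) = (¬ (x ∈ᵥ xs)) × Distinct xs
  where
  open import Data.Vec.Membership.Propositional renaming (_∈_ to _∈ᵥ_)

distinct? : {m n : ℕ} → (v : Vec (Fin m) n) → Dec (Distinct v)
distinct? []       = yes Data.Unit.tt where import Data.Unit
distinct? (x ∷ xs) = ¬? (Data.Vec.Membership.DecPropositional._∈?_ Data.Fin._≟_ x xs) ×-dec distinct? xs
  where import Data.Vec.Membership.DecPropositional
        import Data.Fin

perms : (n : ℕ) → List (Vec (Fin n) n)
perms n = filter distinct? (allVecs n n)

G : (c n : ℕ) → List (Vec (Fin n) n × Vec (Fin c) n)
G c n = cartesianProduct (perms n) (allVecs c n)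

word : {c n : ℕ} → Vec (Fin n) n × Vec (Fin c) n → List (ℕ × ℕ)
word (p , col) = toList (Data.Vec.map (λ q → toℕ (proj₁ q) , toℕ (proj₂ q)) (zip p col))
  where import Data.Vec

count : {A : Set} → (A → ℕ) → List A → ℕ
count f []       = 0
count f (x ∷ xs) = f x + count f xs

ind : {P : Set} → Dec P → ℕ
ind (yes _) = 1
ind (no _)  = 0

invW : List (ℕ × ℕ) → ℕ
invW []       = 0
invW (x ∷ xs) = count (λ y → ind (proj₁ y <? proj₁ x)) xs + invW xs

colW : List (ℕ × ℕ) → ℕ
colW = count proj₂

ascNZ : List (ℕ × ℕ) → ℕ
ascNZ []       = 0
ascNZ (x ∷ xs) = count (λ y → ind ((proj₁ x <? proj₁ y) ×-dec ¬? (proj₂ y ≟ 0))) xs + ascNZ xs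

invc : (c : ℕ) {n : ℕ} → Vec (Fin n) n × Vec (Fin c) n → ℕ
invc c σ = invW (word σ) + colW (word σ) + c * ascNZ (word σ)

ic : (c n k : ℕ) → ℕ
ic c n k = length (filter (λ σ → invc c σ ≟ k) (G c n))

{-# OPTIONS --safe #-}
-- Write M(c, n) = (c - 1) n + c C(n, 2). Take the largest letter n out of a colored permutation
-- of [n + 1] in which it follows p other letters and has color t: what remains is a colored
-- permutation of [n], and inv_c drops by (n - p) + t + c p [t ≠ 0]. As (p, t) ranges over
-- [0, n] × [0, c - 1], this drop takes each value 0, ..., n + (n + 1)(c - 1) exactly once. So the
-- multiset of inv_c values on G_{c,n+1} is the sumset of the one on G_{c,n} with an interval,
-- i.e. the generating function is a product of q-integers. The interval [0, L] is invariant
-- under x ↦ L - x, and the sumset of multisets invariant under x ↦ M - x and x ↦ N - x is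
-- invariant under x ↦ M + N - x, so by induction the values on G_{c,n} are invariant under
-- x ↦ M(c, n) - x.
module Submission where

open import Defs
open import Data.Nat using (ℕ; _+_; _*_; _∸_; _<_; _≤_)
open import Data.Nat.Combinatorics using (_C_)
open import Relation.Binary.PropositionalEquality using (_≡_)

open import Data.Nat using (zero; suc; z≤n; s≤s; _<?_)
open import Data.Nat.Properties
open import Data.Nat.Combinatorics using (nC1≡n; nCk+nC[k+1]≡[n+1]C[k+1])
open import Data.Nat.Solver using (module +-*-Solver)
open +-*-Solver using (solve; _:+_; _:*_; _:=_; con)
open import Data.Bool using (true; false)
open import Data.Product using (_×_; _,_; proj₁; proj₂; ∃₂)
open import Data.Unit using (tt)
open import Data.Fin using (Fin; toℕ; fromℕ<)
import Data.Fin.Properties as Fin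
open import Data.Vec using (Vec; []; _∷_; toList; zip)
import Data.Vec as Vec
import Data.Vec.Properties as VecP
import Data.Vec.Membership.Propositional.Properties as ∈ᵥ
open import Function using (_∘_; mk⇔)
open import Relation.Nullary using (Dec; yes; no; ¬_; does; contradiction)
open import Relation.Nullary.Decidable using (¬?; _×-dec_)
open import Relation.Unary using (Decidable)
open import Relation.Binary.PropositionalEquality
  using (refl; setoid; sym; trans; cong; cong₂; subst; _≢_; module ≡-Reasoning)
open import Data.List
  using (List; concatMap; allFin; []; _∷_; _++_; length; map; filter; take; drop; reverse; upTo; applyUpTo; downFrom; cartesianProduct; cartesianProductWith)
open import Data.List.Properties
  using (map-++; map-cong; length-map; length-drop; length-++-≤ˡ; ∷-injective; filter-accept; filter-reject; ++-identityʳ; map-∘; map-cong-local; map-applyUpTo; applyUpTo-∷ʳ; reverse-downFrom; cartesianProductWith-distribʳ-++; take++drop≡id; length-take)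
open import Data.List.Relation.Unary.All as All using (All; []; _∷_)
import Data.List.Relation.Unary.All.Properties as AllP
open import Data.List.Relation.Unary.Any using (here; there)
open import Data.List.Membership.Propositional using (_∈_)
open import Data.List.Membership.DecPropositional _≟_ using (_∈?_)
import Data.List.Membership.Propositional.Properties as ∈
open import Data.List.Relation.Binary.Permutation.Propositional as Perm
  using (_↭_; ↭-refl; ↭-sym; ↭-trans; ↭-reflexive; ↭⇒↭ₛ; module PermutationReasoning)
import Data.List.Relation.Binary.Permutation.Setoid.Properties as ↭ₛ
open import Data.List.Relation.Binary.BagAndSetEquality using (∼bag⇒↭)
open import Data.List.Membership.Propositional.Properties.WithK using (unique∧set⇒bag)
import Data.List.Relation.Binary.Permutation.Propositional.Properties as ↭
open import Data.List.Relation.Unary.Unique.Propositional using (Unique)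
import Data.List.Relation.Unary.Unique.Propositional.Properties as UP
open import Data.List.Relation.Unary.AllPairs using ([]; _∷_)

private
  variable
    A B D : Set

filter-map : {P : B → Set} (P? : Decidable P) (f : A → B) (xs : List A) →
             filter P? (map f xs) ≡ map f (filter (P? ∘ f) xs)
filter-map P? f [] = refl
filter-map P? f (x ∷ xs) with does (P? (f x))
... | true  = cong (f x ∷_) (filter-map P? f xs)
... | false = filter-map P? f xs

Unique-resp-↭ : {xs ys : List A} → xs ↭ ys → Unique xs → Unique ys
Unique-resp-↭ {A = A} p = ↭ₛ.Unique-resp-↭ (setoid A) (↭⇒↭ₛ p)

Unique-map⁺-local : (f : A → B) {xs : List A} → Unique xs →
                    (∀ {x y} → x ∈ xs → y ∈ xs → f x ≡ f y → x ≡ y) → Unique (map f xs)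
Unique-map⁺-local f {[]}     []           inj = []
Unique-map⁺-local f {x ∷ xs} (x∉xs ∷ xs!) inj =
  All.tabulate fx∉ ∷ Unique-map⁺-local f xs! (λ p q → inj (there p) (there q))
  where
  fx∉ : ∀ {y} → y ∈ map f xs → f x ≢ y
  fx∉ y∈ fx≡y with z , z∈xs , refl ← ∈.∈-map⁻ f y∈ =
    All.lookup x∉xs z∈xs (inj (here refl) (there z∈xs) fx≡y)

split-at-first : {P : A → Set} {x y : A} (as bs : List A) {cs ds : List A} →
                 All (¬_ ∘ P) as → All (¬_ ∘ P) bs → P x → P y →
                 as ++ x ∷ cs ≡ bs ++ y ∷ ds → as ≡ bs × x ≡ y × cs ≡ ds
split-at-first []       []       _           _           _  _  refl = refl , refl , refl
split-at-first []       (b ∷ bs) _           (¬Pb ∷ _)   Px _  refl = contradiction Px ¬Pb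
split-at-first (a ∷ as) []       (¬Pa ∷ _)   _           _  Py refl = contradiction Py ¬Pa
split-at-first (a ∷ as) (b ∷ bs) (_ ∷ ¬Pas) (_ ∷ ¬Pbs) Px Py eq
  with refl , eq′ ← ∷-injective eq
  with refl , refl , refl ← split-at-first as bs ¬Pas ¬Pbs Px Py eq′ = refl , refl , refl

insertAt : ℕ → A → List A → List A
insertAt p x xs = take p xs ++ x ∷ drop p xs

insertAt-↭ : ∀ p (x : A) xs → insertAt p x xs ↭ x ∷ xs
insertAt-↭ p x xs =
  ↭-trans (↭.shift x (take p xs) (drop p xs)) (Perm.prep x (↭-reflexive (take++drop≡id p xs)))

insertAt-length : ∀ (as : List A) x bs → insertAt (length as) x (as ++ bs) ≡ as ++ x ∷ bs
insertAt-length []       x bs = refl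
insertAt-length (a ∷ as) x bs = cong (a ∷_) (insertAt-length as x bs)

map-cartesianProductWith : ∀ {E : Set} (h : D → E) (f : A → B → D) xs ys →
  map h (cartesianProductWith f xs ys) ≡ cartesianProductWith (λ x y → h (f x y)) xs ys
map-cartesianProductWith h f []       ys = refl
map-cartesianProductWith h f (x ∷ xs) ys =
  trans (map-++ h (map (f x) ys) _) (cong₂ _++_ (sym (map-∘ ys)) (map-cartesianProductWith h f xs ys))

cartesianProductWith-mapˡ : ∀ {E : Set} (f : B → D → E) (g : A → B) xs ys →
  cartesianProductWith f (map g xs) ys ≡ cartesianProductWith (f ∘ g) xs ys
cartesianProductWith-mapˡ f g []       ys = refl
cartesianProductWith-mapˡ f g (x ∷ xs) ys = cong (map (f (g x)) ys ++_) (cartesianProductWith-mapˡ f g xs ys)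

cartesianProductWith-mapʳ : ∀ {E : Set} (f : A → D → E) (g : B → D) xs ys →
  cartesianProductWith f xs (map g ys) ≡ cartesianProductWith (λ x y → f x (g y)) xs ys
cartesianProductWith-mapʳ f g []       ys = refl
cartesianProductWith-mapʳ f g (x ∷ xs) ys = cong₂ _++_ (sym (map-∘ ys)) (cartesianProductWith-mapʳ f g xs ys)

cartesianProductWith-cong-local : {f g : A → B → D} (xs : List A) (ys : List B) →
  (∀ {x y} → x ∈ xs → y ∈ ys → f x y ≡ g x y) →
  cartesianProductWith f xs ys ≡ cartesianProductWith g xs ys
cartesianProductWith-cong-local []       ys eq = refl
cartesianProductWith-cong-local (x ∷ xs) ys eq =
  cong₂ _++_ (map-cong-local (All.tabulate (eq (here refl))))
             (cartesianProductWith-cong-local xs ys (eq ∘ there))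

cartesianProductWith-↭ˡ : (f : A → B → D) {xs xs′ : List A} (ys : List B) → xs ↭ xs′ →
  cartesianProductWith f xs ys ↭ cartesianProductWith f xs′ ys
cartesianProductWith-↭ˡ f ys Perm.refl         = ↭-refl
cartesianProductWith-↭ˡ f ys (Perm.prep x p)   = ↭.++⁺ˡ (map (f x) ys) (cartesianProductWith-↭ˡ f ys p)
cartesianProductWith-↭ˡ f ys (Perm.swap x y p) =
  ↭-trans (↭.shifts (map (f x) ys) (map (f y) ys))
          (↭.++⁺ˡ (map (f y) ys) (↭.++⁺ˡ (map (f x) ys) (cartesianProductWith-↭ˡ f ys p)))
cartesianProductWith-↭ˡ f ys (Perm.trans p q)  =
  ↭-trans (cartesianProductWith-↭ˡ f ys p) (cartesianProductWith-↭ˡ f ys q)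

cartesianProductWith-↭ʳ : (f : A → B → D) (xs : List A) {ys ys′ : List B} → ys ↭ ys′ →
  cartesianProductWith f xs ys ↭ cartesianProductWith f xs ys′
cartesianProductWith-↭ʳ f []       p = ↭-refl
cartesianProductWith-↭ʳ f (x ∷ xs) p = ↭.++⁺ (↭.map⁺ (f x) p) (cartesianProductWith-↭ʳ f xs p)

cartesianProductWith-consʳ-↭ : (f : A → B → D) (xs : List A) (y : B) (ys : List B) →
  cartesianProductWith f xs (y ∷ ys) ↭ map (λ x → f x y) xs ++ cartesianProductWith f xs ys
cartesianProductWith-consʳ-↭ f []       y ys = ↭-refl
cartesianProductWith-consʳ-↭ f (x ∷ xs) y ys =
  Perm.prep (f x y) (↭-trans (↭.++⁺ˡ (map (f x) ys) (cartesianProductWith-consʳ-↭ f xs y ys))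
                             (↭.shifts (map (f x) ys) (map (λ x → f x y) xs)))

applyUpTo-+ : (f : ℕ → A) (m n : ℕ) → applyUpTo f (m + n) ≡ applyUpTo f m ++ applyUpTo (f ∘ (m +_)) n
applyUpTo-+ f zero    n = refl
applyUpTo-+ f (suc m) n = cong (f 0 ∷_) (applyUpTo-+ (f ∘ suc) m n)

applyUpTo-reflect : ∀ m → applyUpTo (m ∸_) (suc m) ≡ downFrom (suc m)
applyUpTo-reflect zero    = refl
applyUpTo-reflect (suc m) = cong (suc m ∷_) (applyUpTo-reflect m)

upTo-reflect-↭ : ∀ m → map (m ∸_) (upTo (suc m)) ↭ upTo (suc m)
upTo-reflect-↭ m = begin
  map (m ∸_) (upTo (suc m))  ≡⟨ map-applyUpTo (λ i → i) (m ∸_) (suc m) ⟩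
  applyUpTo (m ∸_) (suc m)   ≡⟨ applyUpTo-reflect m ⟩
  downFrom (suc m)           ↭⟨ ↭.↭-reverse (downFrom (suc m)) ⟨
  reverse (downFrom (suc m)) ≡⟨ reverse-downFrom (suc m) ⟩
  upTo (suc m)               ∎
  where open PermutationReasoning

upTo-grid : ∀ m k → cartesianProductWith (λ p s → p * k + s) (upTo m) (upTo k) ≡ upTo (m * k)
upTo-grid zero    k = refl
upTo-grid (suc m) k = begin
  cartesianProductWith g (upTo (suc m)) (upTo k)
    ≡⟨ cong (λ ps → cartesianProductWith g ps (upTo k)) (applyUpTo-∷ʳ (λ i → i) m) ⟨
  cartesianProductWith g (upTo m ++ m ∷ []) (upTo k)
    ≡⟨ cartesianProductWith-distribʳ-++ g (upTo m) (m ∷ []) (upTo k) ⟩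
  cartesianProductWith g (upTo m) (upTo k) ++ (map (g m) (upTo k) ++ [])
    ≡⟨ cong₂ _++_ (upTo-grid m k) (trans (++-identityʳ _) (map-applyUpTo (λ i → i) (g m) k)) ⟩
  upTo (m * k) ++ applyUpTo (m * k +_) k
    ≡⟨ applyUpTo-+ (λ i → i) (m * k) k ⟨
  upTo (m * k + k)
    ≡⟨ cong upTo (+-comm (m * k) k) ⟩
  upTo (suc m * k) ∎
  where
  open ≡-Reasoning
  g : ℕ → ℕ → ℕ
  g p s = p * k + s

All-≤∧≢⇒< : ∀ {n} {xs : List ℕ} → All (_< suc n) xs → All (n ≢_) xs → All (_< n) xs
All-≤∧≢⇒< xs<1+n n∉xs = All.zipWith (λ (x<1+n , n≢x) → ≤∧≢⇒< (≤-pred x<1+n) (n≢x ∘ sym)) (xs<1+n , n∉xs)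

Unique-length-≤ : ∀ n {xs : List ℕ} → Unique xs → All (_< n) xs → length xs ≤ n
Unique-length-≤ zero    {[]}    _  _          = z≤n
Unique-length-≤ zero    {_ ∷ _} _  (() ∷ _)
Unique-length-≤ (suc n) {xs} xs! xs<1+n with n ∈? xs
... | no n∉xs = m≤n⇒m≤1+n (Unique-length-≤ n xs! (All-≤∧≢⇒< xs<1+n (AllP.¬Any⇒All¬ xs n∉xs)))
... | yes n∈xs
  with as , bs , refl ← ∈.∈-∃++ n∈xs
  with n∉rest ∷ rest! ← Unique-resp-↭ (↭.shift n as bs) xs!
  with _ ∷ rest<1+n ← ↭.All-resp-↭ (↭.shift n as bs) xs<1+n = begin
    length (as ++ n ∷ bs)   ≡⟨ ↭.↭-length (↭.shift n as bs) ⟩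
    suc (length (as ++ bs)) ≤⟨ s≤s (Unique-length-≤ n rest! (All-≤∧≢⇒< rest<1+n n∉rest)) ⟩
    suc n                   ∎
  where open ≤-Reasoning

Unique-full⇒max∈ : ∀ n {xs : List ℕ} → Unique xs → All (_< suc n) xs → length xs ≡ suc n → n ∈ xs
Unique-full⇒max∈ n {xs} xs! xs<1+n |xs|≡1+n with n ∈? xs
... | yes n∈xs = n∈xs
... | no  n∉xs = contradiction
  (subst (_≤ n) |xs|≡1+n (Unique-length-≤ n xs! (All-≤∧≢⇒< xs<1+n (AllP.¬Any⇒All¬ xs n∉xs))))
  (<-irrefl refl)

-- Multisets of natural numbers symmetric under reflection

multiplicity : ℕ → List ℕ → ℕ
multiplicity k xs = length (filter (_≟ k) xs)

multiplicity-resp-↭ : ∀ k {xs ys} → xs ↭ ys → multiplicity k xs ≡ multiplicity k ys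
multiplicity-resp-↭ k p = ↭.↭-length (↭.filter-↭ (_≟ k) p)

multiplicity-accept : ∀ {k x} xs → x ≡ k → multiplicity k (x ∷ xs) ≡ suc (multiplicity k xs)
multiplicity-accept {k} xs x≡k = cong length (filter-accept (_≟ k) x≡k)

multiplicity-reject : ∀ {k x} xs → x ≢ k → multiplicity k (x ∷ xs) ≡ multiplicity k xs
multiplicity-reject {k} xs x≢k = cong length (filter-reject (_≟ k) x≢k)

multiplicity-map-reflect : ∀ {M k} xs → All (_≤ M) xs → k ≤ M →
                           multiplicity k (map (M ∸_) xs) ≡ multiplicity (M ∸ k) xs
multiplicity-map-reflect []       _ _ = refl
multiplicity-map-reflect {M} {k} (x ∷ xs) (x≤M ∷ xs≤M) k≤M with x ≟ M ∸ k
... | yes x≡M∸k = begin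
  multiplicity k (M ∸ x ∷ map (M ∸_) xs) ≡⟨ multiplicity-accept (map (M ∸_) xs) M∸x≡k ⟩
  suc (multiplicity k (map (M ∸_) xs))   ≡⟨ cong suc (multiplicity-map-reflect xs xs≤M k≤M) ⟩
  suc (multiplicity (M ∸ k) xs)          ≡⟨ multiplicity-accept xs x≡M∸k ⟨
  multiplicity (M ∸ k) (x ∷ xs)          ∎
  where
  open ≡-Reasoning
  M∸x≡k : M ∸ x ≡ k
  M∸x≡k = trans (cong (M ∸_) x≡M∸k) (m∸[m∸n]≡n k≤M)
... | no x≢M∸k = begin
  multiplicity k (M ∸ x ∷ map (M ∸_) xs) ≡⟨ multiplicity-reject (map (M ∸_) xs) M∸x≢k ⟩
  multiplicity k (map (M ∸_) xs)         ≡⟨ multiplicity-map-reflect xs xs≤M k≤M ⟩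
  multiplicity (M ∸ k) xs                ≡⟨ multiplicity-reject xs x≢M∸k ⟨
  multiplicity (M ∸ k) (x ∷ xs)          ∎
  where
  open ≡-Reasoning
  M∸x≢k : M ∸ x ≢ k
  M∸x≢k M∸x≡k = x≢M∸k (trans (sym (m∸[m∸n]≡n x≤M)) (cong (M ∸_) M∸x≡k))

-- The generating polynomial of xs is palindromic of degree M.
Palindromic : ℕ → List ℕ → Set
Palindromic M xs = All (_≤ M) xs × map (M ∸_) xs ↭ xs

multiplicity-reflect : ∀ {M xs} k → Palindromic M xs → k ≤ M →
                       multiplicity k xs ≡ multiplicity (M ∸ k) xs
multiplicity-reflect {M} {xs} k (xs≤M , reflect) k≤M =
  trans (multiplicity-resp-↭ k (↭-sym reflect)) (multiplicity-map-reflect xs xs≤M k≤M)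

Palindromic-resp-↭ : ∀ {M xs ys} → xs ↭ ys → Palindromic M xs → Palindromic M ys
Palindromic-resp-↭ {M} p (xs≤M , reflect) =
  ↭.All-resp-↭ p xs≤M , ↭-trans (↭.map⁺ (M ∸_) (↭-sym p)) (↭-trans reflect p)

upTo-palindromic : ∀ m → Palindromic m (upTo (suc m))
upTo-palindromic m = All.tabulate (≤-pred ∘ ∈.∈-upTo⁻) , upTo-reflect-↭ m

_⊕_ : List ℕ → List ℕ → List ℕ
_⊕_ = cartesianProductWith _+_

[m+n]∸[o+p]≡[m∸o]+[n∸p] : ∀ {M N x y} → x ≤ M → y ≤ N → (M + N) ∸ (x + y) ≡ (M ∸ x) + (N ∸ y)
[m+n]∸[o+p]≡[m∸o]+[n∸p] {M} {N} {x} {y} x≤M y≤N = begin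
  (M + N) ∸ (x + y)   ≡⟨ ∸-+-assoc (M + N) x y ⟨
  (M + N) ∸ x ∸ y     ≡⟨ cong (_∸ y) (+-∸-comm N x≤M) ⟩
  (M ∸ x) + N ∸ y     ≡⟨ +-∸-assoc (M ∸ x) y≤N ⟩
  (M ∸ x) + (N ∸ y)   ∎
  where open ≡-Reasoning

⊕-palindromic : ∀ {M N xs ys} → Palindromic M xs → Palindromic N ys → Palindromic (M + N) (xs ⊕ ys)
⊕-palindromic {M} {N} {xs} {ys} (xs≤M , xs-reflect) (ys≤N , ys-reflect) = bounded , reflect
  where
  bounded : All (_≤ M + N) (xs ⊕ ys)
  bounded = AllP.cartesianProductWith⁺ (setoid ℕ) (setoid ℕ) _+_ xs ys
    (λ x∈ y∈ → +-mono-≤ (All.lookup xs≤M x∈) (All.lookup ys≤N y∈))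
  reflect : map (M + N ∸_) (xs ⊕ ys) ↭ xs ⊕ ys
  reflect = begin
    map (M + N ∸_) (xs ⊕ ys)
      ≡⟨ map-cartesianProductWith (M + N ∸_) _+_ xs ys ⟩
    cartesianProductWith (λ x y → M + N ∸ (x + y)) xs ys
      ≡⟨ cartesianProductWith-cong-local xs ys
           (λ x∈ y∈ → [m+n]∸[o+p]≡[m∸o]+[n∸p] (All.lookup xs≤M x∈) (All.lookup ys≤N y∈)) ⟩
    cartesianProductWith (λ x y → (M ∸ x) + (N ∸ y)) xs ys
      ≡⟨ cartesianProductWith-mapʳ (λ x v → (M ∸ x) + v) (N ∸_) xs ys ⟨
    cartesianProductWith (λ x v → (M ∸ x) + v) xs (map (N ∸_) ys)
      ≡⟨ cartesianProductWith-mapˡ _+_ (M ∸_) xs (map (N ∸_) ys) ⟨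
    map (M ∸_) xs ⊕ map (N ∸_) ys
      ↭⟨ cartesianProductWith-↭ˡ _+_ (map (N ∸_) ys) xs-reflect ⟩
    xs ⊕ map (N ∸_) ys
      ↭⟨ cartesianProductWith-↭ʳ _+_ xs ys-reflect ⟩
    xs ⊕ ys ∎
    where open PermutationReasoning

-- Colored permutations as words

Word : Set
Word = List (ℕ × ℕ)

letters : Word → List ℕ
letters = map proj₁

colors : Word → List ℕ
colors = map proj₂

record IsColoredPerm (c n : ℕ) (w : Word) : Set where
  constructor isColoredPerm
  field
    length≡          : length w ≡ n
    letters-bounded  : All (_< n) (letters w)
    colors-bounded   : All (_< c) (colors w)
    letters-distinct : Unique (letters w)

IsColoredPerm-resp-↭ : ∀ {c n w w′} → w ↭ w′ → IsColoredPerm c n w → IsColoredPerm c n w′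
IsColoredPerm-resp-↭ p (isColoredPerm |w|≡n ls<n cs<c ls!) = isColoredPerm
  (trans (sym (↭.↭-length p)) |w|≡n)
  (↭.All-resp-↭ (↭.map⁺ proj₁ p) ls<n)
  (↭.All-resp-↭ (↭.map⁺ proj₂ p) cs<c)
  (Unique-resp-↭ (↭.map⁺ proj₁ p) ls!)

IsColoredPerm-∷⁺ : ∀ {c n t w} → IsColoredPerm c n w → t < c → IsColoredPerm c (suc n) ((n , t) ∷ w)
IsColoredPerm-∷⁺ {n = n} (isColoredPerm |w|≡n ls<n cs<c ls!) t<c = isColoredPerm
  (cong suc |w|≡n)
  (n<1+n n ∷ All.map m<n⇒m<1+n ls<n)
  (t<c ∷ cs<c)
  (All.map >⇒≢ ls<n ∷ ls!)

IsColoredPerm-∷⁻ : ∀ {c n t w} → IsColoredPerm c (suc n) ((n , t) ∷ w) → IsColoredPerm c n w × t < c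
IsColoredPerm-∷⁻ (isColoredPerm |w|≡1+n (_ ∷ ls<1+n) (t<c ∷ cs<c) (n∉ls ∷ ls!)) =
  isColoredPerm (suc-injective |w|≡1+n) (All-≤∧≢⇒< ls<1+n n∉ls) cs<c ls! , t<c

-- Defs.word for words of any length m: word (p , q) unfolds to coloredWord p q.
coloredWord : ∀ {n c m} → Vec (Fin n) m → Vec (Fin c) m → Word
coloredWord p q = toList (Vec.map (λ x → toℕ (proj₁ x) , toℕ (proj₂ x)) (zip p q))

coloredWord-injective : ∀ {n c m} {p p′ : Vec (Fin n) m} {q q′ : Vec (Fin c) m} →
                        coloredWord p q ≡ coloredWord p′ q′ → (p , q) ≡ (p′ , q′)
coloredWord-injective {p = []}    {[]}      {[]}    {[]}      _  = refl
coloredWord-injective {p = x ∷ p} {x′ ∷ p′} {y ∷ q} {y′ ∷ q′} eq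
  with head≡ , tail≡ ← ∷-injective eq
  with refl ← coloredWord-injective tail≡
  with refl ← Fin.toℕ-injective (cong proj₁ head≡)
  with refl ← Fin.toℕ-injective (cong proj₂ head≡) = refl

coloredWord-length : ∀ {n c m} (p : Vec (Fin n) m) (q : Vec (Fin c) m) → length (coloredWord p q) ≡ m
coloredWord-length []      []      = refl
coloredWord-length (x ∷ p) (y ∷ q) = cong suc (coloredWord-length p q)

letters-coloredWord : ∀ {n c m} (p : Vec (Fin n) m) (q : Vec (Fin c) m) →
                      letters (coloredWord p q) ≡ map toℕ (toList p)
letters-coloredWord []      []      = refl
letters-coloredWord (x ∷ p) (y ∷ q) = cong (toℕ x ∷_) (letters-coloredWord p q)

colors-coloredWord : ∀ {n c m} (p : Vec (Fin n) m) (q : Vec (Fin c) m) →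
                     colors (coloredWord p q) ≡ map toℕ (toList q)
colors-coloredWord []      []      = refl
colors-coloredWord (x ∷ p) (y ∷ q) = cong (toℕ y ∷_) (colors-coloredWord p q)

Distinct⇒Unique-toList : ∀ {n m} {p : Vec (Fin n) m} → Distinct p → Unique (toList p)
Distinct⇒Unique-toList {p = []}    _          = []
Distinct⇒Unique-toList {p = x ∷ p} (x∉p , p!) =
  AllP.¬Any⇒All¬ (toList p) (x∉p ∘ ∈ᵥ.∈-toList⁻) ∷ Distinct⇒Unique-toList p!

Unique-toList⇒Distinct : ∀ {n m} {p : Vec (Fin n) m} → Unique (toList p) → Distinct p
Unique-toList⇒Distinct {p = []}    _          = tt
Unique-toList⇒Distinct {p = x ∷ p} (x∉p ∷ p!) =
  AllP.All¬⇒¬Any x∉p ∘ ∈ᵥ.∈-toList⁺ , Unique-toList⇒Distinct p!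

coloredWord-surjective : ∀ {n c} m (w : Word) → length w ≡ m → All (_< n) (letters w) → All (_< c) (colors w) →
                         ∃₂ λ (p : Vec (Fin n) m) (q : Vec (Fin c) m) → coloredWord p q ≡ w
coloredWord-surjective zero    []            _       _            _            = [] , [] , refl
coloredWord-surjective (suc m) ((v , t) ∷ w) |w|≡1+m (v<n ∷ ls<n) (t<c ∷ cs<c)
  with p , q , refl ← coloredWord-surjective m w (suc-injective |w|≡1+m) ls<n cs<c =
  fromℕ< v<n ∷ p , fromℕ< t<c ∷ q ,
  cong₂ (λ a b → (a , b) ∷ coloredWord p q) (Fin.toℕ-fromℕ< v<n) (Fin.toℕ-fromℕ< t<c)

allVecs-suc : ∀ m n → allVecs m (suc n) ≡ cartesianProductWith _∷_ (allFin m) (allVecs m n)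
allVecs-suc m n = go (allFin m)
  where
  go : ∀ xs → concatMap (λ x → map (x ∷_) (allVecs m n)) xs ≡ cartesianProductWith _∷_ xs (allVecs m n)
  go []       = refl
  go (x ∷ xs) = cong (map (x ∷_) (allVecs m n) ++_) (go xs)

∈-allVecs : ∀ {m n} (v : Vec (Fin m) n) → v ∈ allVecs m n
∈-allVecs {n = zero}  []      = here refl
∈-allVecs {m} {suc n} (x ∷ v) rewrite allVecs-suc m n =
  ∈.∈-cartesianProductWith⁺ _∷_ (∈.∈-allFin x) (∈-allVecs v)

allVecs-unique : ∀ m n → Unique (allVecs m n)
allVecs-unique m zero    = [] ∷ []
allVecs-unique m (suc n) rewrite allVecs-suc m n =
  UP.cartesianProductWith⁺ _∷_ VecP.∷-injective (UP.allFin⁺ m) (allVecs-unique m n)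

words : ℕ → ℕ → List Word
words c n = map word (G c n)

words-unique : ∀ c n → Unique (words c n)
words-unique c n = UP.map⁺ coloredWord-injective
  (UP.cartesianProduct⁺ (UP.filter⁺ distinct? (allVecs-unique n n)) (allVecs-unique c n))

∈-words⁻ : ∀ {c n w} → w ∈ words c n → IsColoredPerm c n w
∈-words⁻ {c} {n} w∈
  with (p , q) , σ∈ , refl ← ∈.∈-map⁻ word w∈
  with p∈ , _ ← ∈.∈-cartesianProduct⁻ (perms n) (allVecs c n) σ∈
  with _ , p! ← ∈.∈-filter⁻ distinct? {xs = allVecs n n} p∈ = isColoredPerm
  (coloredWord-length p q)
  (subst (All (_< n)) (sym (letters-coloredWord p q)) (AllP.map⁺ (All.universal Fin.toℕ<n (toList p))))
  (subst (All (_< c)) (sym (colors-coloredWord p q)) (AllP.map⁺ (All.universal Fin.toℕ<n (toList q))))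
  (subst Unique (sym (letters-coloredWord p q)) (UP.map⁺ Fin.toℕ-injective (Distinct⇒Unique-toList p!)))

∈-words⁺ : ∀ {c n w} → IsColoredPerm c n w → w ∈ words c n
∈-words⁺ {c} {n} (isColoredPerm |w|≡n ls<n cs<c ls!)
  with p , q , refl ← coloredWord-surjective n _ |w|≡n ls<n cs<c =
  ∈.∈-map⁺ word (∈.∈-cartesianProduct⁺ (∈.∈-filter⁺ distinct? (∈-allVecs p) p!) (∈-allVecs q))
  where
  p! : Distinct p
  p! = Unique-toList⇒Distinct (UP.map⁻ (subst Unique (letters-coloredWord p q) ls!))

-- Inserting the largest letter

invcWord : ℕ → Word → ℕ
invcWord c w = invW w + colW w + c * ascNZ w

nonzero : ℕ → ℕ
nonzero t = ind (¬? (t ≟ 0))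

ind-yes : ∀ {P : Set} (P? : Dec P) → P → ind P? ≡ 1
ind-yes (yes _) _ = refl
ind-yes (no ¬p) p = contradiction p ¬p

ind-no : ∀ {P : Set} (P? : Dec P) → ¬ P → ind P? ≡ 0
ind-no (yes p) ¬p = contradiction p ¬p
ind-no (no _)  _  = refl

ind-×-yes : ∀ {P Q : Set} (P? : Dec P) (Q? : Dec Q) → P → ind (P? ×-dec Q?) ≡ ind Q?
ind-×-yes (yes _) (yes _) _ = refl
ind-×-yes (yes _) (no _)  _ = refl
ind-×-yes (no ¬p) _       p = contradiction p ¬p

count-insert : (f : A → ℕ) (as bs : List A) (x : A) → count f (as ++ x ∷ bs) ≡ count f (as ++ bs) + f x
count-insert f []       bs x = +-comm (f x) (count f bs)
count-insert f (a ∷ as) bs x = trans (cong (f a +_) (count-insert f as bs x)) (sym (+-assoc (f a) _ (f x)))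

count-zero : {f : A → ℕ} (xs : List A) → All (λ x → f x ≡ 0) xs → count f xs ≡ 0
count-zero []       []             = refl
count-zero (x ∷ xs) (fx≡0 ∷ fxs≡0) = cong₂ _+_ fx≡0 (count-zero xs fxs≡0)

count-one : {f : A → ℕ} (xs : List A) → All (λ x → f x ≡ 1) xs → count f xs ≡ length xs
count-one []       []             = refl
count-one (x ∷ xs) (fx≡1 ∷ fxs≡1) = cong₂ _+_ fx≡1 (count-one xs fxs≡1)

module _ {n t : ℕ} where

  invW-insert : ∀ as bs → All (_< n) (letters (as ++ bs)) →
                invW (as ++ (n , t) ∷ bs) ≡ invW (as ++ bs) + length bs
  invW-insert [] bs ls<n =
    trans (cong (_+ invW bs) (count-one bs (All.map (ind-yes (_ <? n)) (AllP.map⁻ ls<n))))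
          (+-comm (length bs) (invW bs))
  invW-insert (a ∷ as) bs (a<n ∷ ls<n) = begin
    count below-a (as ++ (n , t) ∷ bs) + invW (as ++ (n , t) ∷ bs)
      ≡⟨ cong₂ _+_ (count-insert below-a as bs (n , t)) (invW-insert as bs ls<n) ⟩
    (count below-a (as ++ bs) + ind (n <? proj₁ a)) + (invW (as ++ bs) + length bs)
      ≡⟨ cong (λ i → (count below-a (as ++ bs) + i) + _) (ind-no (n <? proj₁ a) (<⇒≯ a<n)) ⟩
    (count below-a (as ++ bs) + 0) + (invW (as ++ bs) + length bs)
      ≡⟨ cong (_+ (invW (as ++ bs) + length bs)) (+-identityʳ (count below-a (as ++ bs))) ⟩
    count below-a (as ++ bs) + (invW (as ++ bs) + length bs)
      ≡⟨ +-assoc (count below-a (as ++ bs)) _ _ ⟨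
    count below-a (as ++ bs) + invW (as ++ bs) + length bs ∎
    where
    open ≡-Reasoning
    below-a : ℕ × ℕ → ℕ
    below-a y = ind (proj₁ y <? proj₁ a)

  colW-insert : ∀ as bs → colW (as ++ (n , t) ∷ bs) ≡ colW (as ++ bs) + t
  colW-insert as bs = count-insert proj₂ as bs (n , t)

  ascNZ-insert : ∀ as bs → All (_< n) (letters (as ++ bs)) →
                 ascNZ (as ++ (n , t) ∷ bs) ≡ ascNZ (as ++ bs) + length as * nonzero t
  ascNZ-insert [] bs ls<n =
    trans (cong (_+ ascNZ bs) (count-zero bs (All.map (λ {y} y<n → ind-no ((n <? proj₁ y) ×-dec _) ((<⇒≯ y<n) ∘ proj₁))
                                                     (AllP.map⁻ ls<n))))
          (sym (+-identityʳ (ascNZ bs)))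
  ascNZ-insert (a ∷ as) bs (a<n ∷ ls<n) = begin
    count above-a (as ++ (n , t) ∷ bs) + ascNZ (as ++ (n , t) ∷ bs)
      ≡⟨ cong₂ _+_ (count-insert above-a as bs (n , t)) (ascNZ-insert as bs ls<n) ⟩
    (count above-a (as ++ bs) + above-a (n , t)) + (ascNZ (as ++ bs) + length as * nonzero t)
      ≡⟨ cong (λ i → (count above-a (as ++ bs) + i) + _) (ind-×-yes (proj₁ a <? n) _ a<n) ⟩
    (count above-a (as ++ bs) + nonzero t) + (ascNZ (as ++ bs) + length as * nonzero t)
      ≡⟨ solve 4 (λ C e A l → (C :+ e) :+ (A :+ l :* e) := (C :+ A) :+ (e :+ l :* e))
               refl (count above-a (as ++ bs)) (nonzero t) (ascNZ (as ++ bs)) (length as) ⟩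
    count above-a (as ++ bs) + ascNZ (as ++ bs) + suc (length as) * nonzero t ∎
    where
    open ≡-Reasoning
    above-a : ℕ × ℕ → ℕ
    above-a y = ind ((proj₁ a <? proj₁ y) ×-dec ¬? (proj₂ y ≟ 0))

  invcWord-insert : ∀ c as bs → All (_< n) (letters (as ++ bs)) →
    invcWord c (as ++ (n , t) ∷ bs) ≡ invcWord c (as ++ bs) + (length bs + t + c * (length as * nonzero t))
  invcWord-insert c as bs ls<n
    rewrite invW-insert as bs ls<n | colW-insert as bs | ascNZ-insert as bs ls<n =
    solve 7 (λ I l C τ c A e → (I :+ l) :+ (C :+ τ) :+ c :* (A :+ e) := I :+ C :+ c :* A :+ (l :+ τ :+ c :* e))
          refl (invW (as ++ bs)) (length bs) (colW (as ++ bs)) t c (ascNZ (as ++ bs)) (length as * nonzero t)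

-- Placed after p letters of a word on [n], the letter n forms n ∸ p inversions and, if its
-- color t is nonzero, p of the pairs counted by ascNZ.
slotWeight : ℕ → ℕ → ℕ × ℕ → ℕ
slotWeight c n (p , t) = (n ∸ p) + t + c * (p * nonzero t)

invcWord-insertAt : ∀ c {n p t} w → length w ≡ n → All (_< n) (letters w) → p ≤ n →
                    invcWord c (insertAt p (n , t) w) ≡ invcWord c w + slotWeight c n (p , t)
invcWord-insertAt c {n} {p} {t} w |w|≡n ls<n p≤n = begin
  invcWord c (take p w ++ (n , t) ∷ drop p w)
    ≡⟨ invcWord-insert c (take p w) (drop p w) (subst (All (_< n) ∘ letters) (sym (take++drop≡id p w)) ls<n) ⟩
  invcWord c (take p w ++ drop p w) + (length (drop p w) + t + c * (length (take p w) * nonzero t))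
    ≡⟨ cong₂ (λ v d → invcWord c v + (d + t + c * (length (take p w) * nonzero t)))
             (take++drop≡id p w) (trans (length-drop p w) (cong (_∸ p) |w|≡n)) ⟩
  invcWord c w + ((n ∸ p) + t + c * (length (take p w) * nonzero t))
    ≡⟨ cong (λ l → invcWord c w + ((n ∸ p) + t + c * (l * nonzero t)))
            (trans (length-take p w) (m≤n⇒m⊓n≡m (subst (p ≤_) (sym |w|≡n) p≤n))) ⟩
  invcWord c w + slotWeight c n (p , t) ∎
  where open ≡-Reasoning

insertAt-injective : ∀ {n p p′ t t′} (w w′ : Word) → p ≤ length w → p′ ≤ length w′ →
                     All (_< n) (letters w) → All (_< n) (letters w′) →
                     insertAt p (n , t) w ≡ insertAt p′ (n , t′) w′ → w ≡ w′ × p ≡ p′ × t ≡ t′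
insertAt-injective {n} {p} {p′} w w′ p≤|w| p′≤|w′| ls<n ls′<n eq
  with take≡ , refl , drop≡ ← split-at-first (take p w) (take p′ w′)
         (AllP.take⁺ p (All.map <⇒≢ (AllP.map⁻ ls<n))) (AllP.take⁺ p′ (All.map <⇒≢ (AllP.map⁻ ls′<n)))
         refl refl eq =
  w≡w′ , p≡p′ , refl
  where
  w≡w′ : w ≡ w′
  w≡w′ = trans (sym (take++drop≡id p w)) (trans (cong₂ _++_ take≡ drop≡) (take++drop≡id p′ w′))
  length-take-≤ : ∀ {q} (v : Word) → q ≤ length v → length (take q v) ≡ q
  length-take-≤ {q} v q≤|v| = trans (length-take q v) (m≤n⇒m⊓n≡m q≤|v|)
  p≡p′ : p ≡ p′
  p≡p′ = trans (sym (length-take-≤ w p≤|w|)) (trans (cong length take≡) (length-take-≤ w′ p′≤|w′|))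

slots : ℕ → ℕ → List (ℕ × ℕ)
slots c n = cartesianProduct (upTo (suc n)) (upTo c)

insertTop : ℕ → Word × (ℕ × ℕ) → Word
insertTop n (w , (p , t)) = insertAt p (n , t) w

insertions : ℕ → ℕ → List Word
insertions c n = map (insertTop n) (cartesianProduct (words c n) (slots c n))

∈-insertions⁻ : ∀ {c n w′} → w′ ∈ insertions c n → IsColoredPerm c (suc n) w′
∈-insertions⁻ {c} {n} w′∈
  with (w , (p , t)) , x∈ , refl ← ∈.∈-map⁻ (insertTop n) w′∈
  with w∈ , pt∈ ← ∈.∈-cartesianProduct⁻ (words c n) (slots c n) x∈
  with _ , t∈ ← ∈.∈-cartesianProduct⁻ (upTo (suc n)) (upTo c) pt∈ =
  IsColoredPerm-resp-↭ (↭-sym (insertAt-↭ p (n , t) w)) (IsColoredPerm-∷⁺ (∈-words⁻ w∈) (∈.∈-upTo⁻ t∈))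

∈-insertions⁺ : ∀ {c n w′} → IsColoredPerm c (suc n) w′ → w′ ∈ insertions c n
∈-insertions⁺ {c} {n} {w′} w′-perm@(isColoredPerm |w′|≡1+n ls<1+n _ ls!)
  with (_ , t) , nt∈ , refl ← ∈.∈-map⁻ proj₁ (Unique-full⇒max∈ n ls! ls<1+n (trans (length-map proj₁ w′) |w′|≡1+n))
  with as , bs , refl ← ∈.∈-∃++ nt∈
  with w-perm , t<c ← IsColoredPerm-∷⁻ (IsColoredPerm-resp-↭ (↭.shift (n , t) as bs) w′-perm) =
  subst (_∈ insertions c n) (insertAt-length as (n , t) bs)
    (∈.∈-map⁺ (insertTop n) (∈.∈-cartesianProduct⁺ (∈-words⁺ w-perm)
      (∈.∈-cartesianProduct⁺ (∈.∈-upTo⁺ (s≤s |as|≤n)) (∈.∈-upTo⁺ t<c))))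
  where
  |as|≤n : length as ≤ n
  |as|≤n = subst (length as ≤_) (IsColoredPerm.length≡ w-perm) (length-++-≤ˡ as)

insertions-unique : ∀ c n → Unique (insertions c n)
insertions-unique c n = Unique-map⁺-local (insertTop n)
  (UP.cartesianProduct⁺ (words-unique c n) (UP.cartesianProduct⁺ (UP.upTo⁺ (suc n)) (UP.upTo⁺ c)))
  insertTop-injective
  where
  insertTop-injective : ∀ {x y} → x ∈ cartesianProduct (words c n) (slots c n) →
                        y ∈ cartesianProduct (words c n) (slots c n) → insertTop n x ≡ insertTop n y → x ≡ y
  insertTop-injective {w , (p , t)} {w′ , (p′ , t′)} x∈ y∈ eq
    with w∈ , pt∈ ← ∈.∈-cartesianProduct⁻ (words c n) (slots c n) x∈
    with w′∈ , pt′∈ ← ∈.∈-cartesianProduct⁻ (words c n) (slots c n) y∈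
    with p∈ , _ ← ∈.∈-cartesianProduct⁻ (upTo (suc n)) (upTo c) pt∈
    with p′∈ , _ ← ∈.∈-cartesianProduct⁻ (upTo (suc n)) (upTo c) pt′∈
    with isColoredPerm |w|≡n ls<n _ _ ← ∈-words⁻ w∈
    with isColoredPerm |w′|≡n ls′<n _ _ ← ∈-words⁻ w′∈
    with refl , refl , refl ← insertAt-injective w w′
           (subst (p ≤_) (sym |w|≡n) (≤-pred (∈.∈-upTo⁻ p∈)))
           (subst (p′ ≤_) (sym |w′|≡n) (≤-pred (∈.∈-upTo⁻ p′∈))) ls<n ls′<n eq = refl

words-suc-↭ : ∀ c n → words c (suc n) ↭ insertions c n
words-suc-↭ c n = ∼bag⇒↭ (unique∧set⇒bag (words-unique c (suc n)) (insertions-unique c n)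
  (mk⇔ (∈-insertions⁺ ∘ ∈-words⁻) (∈-words⁺ ∘ ∈-insertions⁻)))

colored-slotWeight : ∀ c′ {n p} s → p ≤ n → slotWeight (suc c′) n (p , suc s) ≡ suc n + (p * c′ + s)
colored-slotWeight c′ {n} {p} s p≤n = begin
  (n ∸ p) + suc s + suc c′ * (p * 1)
    ≡⟨ solve 4 (λ r σ q c → r :+ (con 1 :+ σ) :+ (con 1 :+ c) :* (q :* con 1) := con 1 :+ (r :+ q) :+ (q :* c :+ σ))
             refl (n ∸ p) s p c′ ⟩
  suc ((n ∸ p) + p) + (p * c′ + s)
    ≡⟨ cong (λ m → suc m + (p * c′ + s)) (m∸n+n≡m p≤n) ⟩
  suc n + (p * c′ + s) ∎
  where open ≡-Reasoning

uncolored-slotWeight : ∀ c n p → slotWeight c n (p , 0) ≡ n ∸ p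
uncolored-slotWeight c n p =
  trans (cong₂ _+_ (+-identityʳ (n ∸ p)) (trans (cong (c *_) (*-zeroʳ p)) (*-zeroʳ c))) (+-identityʳ (n ∸ p))

colored-slotWeights : ∀ c′ n →
  cartesianProductWith (λ p t → slotWeight (suc c′) n (p , t)) (upTo (suc n)) (applyUpTo suc c′) ≡
  applyUpTo (suc n +_) (suc n * c′)
colored-slotWeights c′ n = begin
  cartesianProductWith (λ p t → weight (p , t)) (upTo (suc n)) (applyUpTo suc c′)
    ≡⟨ cong (cartesianProductWith (λ p t → weight (p , t)) (upTo (suc n))) (map-applyUpTo (λ i → i) suc c′) ⟨
  cartesianProductWith (λ p t → weight (p , t)) (upTo (suc n)) (map suc (upTo c′))
    ≡⟨ cartesianProductWith-mapʳ (λ p t → weight (p , t)) suc (upTo (suc n)) (upTo c′) ⟩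
  cartesianProductWith (λ p s → weight (p , suc s)) (upTo (suc n)) (upTo c′)
    ≡⟨ cartesianProductWith-cong-local (upTo (suc n)) (upTo c′)
         (λ {_} {s} p∈ _ → colored-slotWeight c′ s (≤-pred (∈.∈-upTo⁻ p∈))) ⟩
  cartesianProductWith (λ p s → suc n + (p * c′ + s)) (upTo (suc n)) (upTo c′)
    ≡⟨ map-cartesianProductWith (suc n +_) (λ p s → p * c′ + s) (upTo (suc n)) (upTo c′) ⟨
  map (suc n +_) (cartesianProductWith (λ p s → p * c′ + s) (upTo (suc n)) (upTo c′))
    ≡⟨ cong (map (suc n +_)) (upTo-grid (suc n) c′) ⟩
  map (suc n +_) (upTo (suc n * c′))
    ≡⟨ map-applyUpTo (λ i → i) (suc n +_) (suc n * c′) ⟩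
  applyUpTo (suc n +_) (suc n * c′) ∎
  where
  open ≡-Reasoning
  weight : ℕ × ℕ → ℕ
  weight = slotWeight (suc c′) n

slotWeights-↭ : ∀ c′ n → map (slotWeight (suc c′) n) (slots (suc c′) n) ↭ upTo (suc (n + suc n * c′))
slotWeights-↭ c′ n = begin
  map weight (cartesianProduct (upTo (suc n)) (upTo (suc c′)))
    ≡⟨ map-cartesianProductWith weight _,_ (upTo (suc n)) (upTo (suc c′)) ⟩
  cartesianProductWith (λ p t → weight (p , t)) (upTo (suc n)) (0 ∷ applyUpTo suc c′)
    ↭⟨ cartesianProductWith-consʳ-↭ (λ p t → weight (p , t)) (upTo (suc n)) 0 (applyUpTo suc c′) ⟩
  map (λ p → weight (p , 0)) (upTo (suc n)) ++
  cartesianProductWith (λ p t → weight (p , t)) (upTo (suc n)) (applyUpTo suc c′)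
    ≡⟨ cong₂ _++_ (map-cong (uncolored-slotWeight (suc c′) n) (upTo (suc n))) (colored-slotWeights c′ n) ⟩
  map (n ∸_) (upTo (suc n)) ++ applyUpTo (suc n +_) (suc n * c′)
    ↭⟨ ↭.++⁺ʳ (applyUpTo (suc n +_) (suc n * c′)) (upTo-reflect-↭ n) ⟩
  upTo (suc n) ++ applyUpTo (suc n +_) (suc n * c′)
    ≡⟨ applyUpTo-+ (λ i → i) (suc n) (suc n * c′) ⟨
  upTo (suc n + suc n * c′) ∎
  where
  open PermutationReasoning
  weight : ℕ × ℕ → ℕ
  weight = slotWeight (suc c′) n

-- Symmetry of the distribution of inv_c

invcValues : ℕ → ℕ → List ℕ
invcValues c n = map (invcWord c) (words c n)

invcValues-suc-↭ : ∀ c n → invcValues c (suc n) ↭ invcValues c n ⊕ map (slotWeight c n) (slots c n)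
invcValues-suc-↭ c n = begin
  map (invcWord c) (words c (suc n))
    ↭⟨ ↭.map⁺ (invcWord c) (words-suc-↭ c n) ⟩
  map (invcWord c) (map (insertTop n) (cartesianProduct (words c n) (slots c n)))
    ≡⟨ map-∘ (cartesianProduct (words c n) (slots c n)) ⟨
  map (invcWord c ∘ insertTop n) (cartesianProduct (words c n) (slots c n))
    ≡⟨ map-cartesianProductWith (invcWord c ∘ insertTop n) _,_ (words c n) (slots c n) ⟩
  cartesianProductWith (λ w s → invcWord c (insertTop n (w , s))) (words c n) (slots c n)
    ≡⟨ cartesianProductWith-cong-local (words c n) (slots c n) insert-weight ⟩
  cartesianProductWith (λ w s → invcWord c w + slotWeight c n s) (words c n) (slots c n)
    ≡⟨ cartesianProductWith-mapʳ (λ w v → invcWord c w + v) (slotWeight c n) (words c n) (slots c n) ⟨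
  cartesianProductWith (λ w v → invcWord c w + v) (words c n) (map (slotWeight c n) (slots c n))
    ≡⟨ cartesianProductWith-mapˡ _+_ (invcWord c) (words c n) (map (slotWeight c n) (slots c n)) ⟨
  invcValues c n ⊕ map (slotWeight c n) (slots c n) ∎
  where
  open PermutationReasoning
  insert-weight : ∀ {w s} → w ∈ words c n → s ∈ slots c n →
                  invcWord c (insertTop n (w , s)) ≡ invcWord c w + slotWeight c n s
  insert-weight {w} {p , t} w∈ s∈
    with p∈ , _ ← ∈.∈-cartesianProduct⁻ (upTo (suc n)) (upTo c) s∈
    with isColoredPerm |w|≡n ls<n _ _ ← ∈-words⁻ w∈ =
    invcWord-insertAt c w |w|≡n ls<n (≤-pred (∈.∈-upTo⁻ p∈))

maxInv : ℕ → ℕ → ℕ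
maxInv c n = (c ∸ 1) * n + c * (n C 2)

maxInv-suc : ∀ c′ n → maxInv (suc c′) (suc n) ≡ maxInv (suc c′) n + (n + suc n * c′)
maxInv-suc c′ n = begin
  c′ * suc n + suc c′ * (suc n C 2)
    ≡⟨ cong (λ m → c′ * suc n + suc c′ * m) (nCk+nC[k+1]≡[n+1]C[k+1] n 1) ⟨
  c′ * suc n + suc c′ * (n C 1 + n C 2)
    ≡⟨ cong (λ m → c′ * suc n + suc c′ * (m + n C 2)) (nC1≡n n) ⟩
  c′ * suc n + suc c′ * (n + n C 2)
    ≡⟨ solve 3 (λ c m b → c :* (con 1 :+ m) :+ (con 1 :+ c) :* (m :+ b) := c :* m :+ (con 1 :+ c) :* b :+ (m :+ (con 1 :+ m) :* c))
             refl c′ n (n C 2) ⟩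
  c′ * n + suc c′ * (n C 2) + (n + suc n * c′) ∎
  where open ≡-Reasoning

invcValues-palindromic : ∀ c′ n → Palindromic (maxInv (suc c′) n) (invcValues (suc c′) n)
invcValues-palindromic c′ zero rewrite *-zeroʳ c′ = (z≤n ∷ []) , ↭-refl
invcValues-palindromic c′ (suc n) =
  subst (λ M → Palindromic M (invcValues (suc c′) (suc n))) (sym (maxInv-suc c′ n))
    (Palindromic-resp-↭ (↭-sym invcValues↭)
      (⊕-palindromic (invcValues-palindromic c′ n) (upTo-palindromic (n + suc n * c′))))
  where
  invcValues↭ : invcValues (suc c′) (suc n) ↭ invcValues (suc c′) n ⊕ upTo (suc (n + suc n * c′))
  invcValues↭ = ↭-trans (invcValues-suc-↭ (suc c′) n)
                        (cartesianProductWith-↭ʳ _+_ (invcValues (suc c′) n) (slotWeights-↭ c′ n))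

ic≡multiplicity : ∀ c n k → ic c n k ≡ multiplicity k (invcValues c n)
ic≡multiplicity c n k = begin
  length (filter ((_≟ k) ∘ invc c) (G c n))
    ≡⟨ length-map (invc c) (filter ((_≟ k) ∘ invc c) (G c n)) ⟨
  length (map (invc c) (filter ((_≟ k) ∘ invc c) (G c n)))
    ≡⟨ cong length (filter-map (_≟ k) (invc c) (G c n)) ⟨
  multiplicity k (map (invc c) (G c n))
    ≡⟨ cong (multiplicity k) (map-∘ (G c n)) ⟩
  multiplicity k (invcValues c n) ∎
  where open ≡-Reasoning

theorem3p1 : (n c k : ℕ) → 1 < n → 1 ≤ c →
    k ≤ (c ∸ 1) * n + c * (n C 2) →
    ic c n k ≡ ic c n ((c ∸ 1) * n + c * (n C 2) ∸ k)
theorem3p1 n zero     k _ () _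
theorem3p1 n (suc c′) k _ _  k≤M = begin
  ic c n k                              ≡⟨ ic≡multiplicity c n k ⟩
  multiplicity k (invcValues c n)       ≡⟨ multiplicity-reflect k (invcValues-palindromic c′ n) k≤M ⟩
  multiplicity (M ∸ k) (invcValues c n) ≡⟨ ic≡multiplicity c n (M ∸ k) ⟨
  ic c n (M ∸ k)                        ∎
  where
  open ≡-Reasoning
  c M : ℕ
  c = suc c′
  M = maxInv c n
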